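{- Let $N$ be a primitive non-deficient number, and write $N = p_1^{a_1} p_2^{a_2} \cdots p_k^{a_k}$ where $p_1, \dots, p_k$ are distinct primes and $a_1,\dots,a_k \ge 1$. Let $R = p_1 p_2 \cdots p_k$. Then there exists $j$ with $1 \le j \le k$ such that $p_j^{a_j+1} < 4R^2$.
   Context: For a positive integer $n$, $\sigma(n)$ denotes the sum of the positive divisors of $n$. A positive integer $n$ is deficient if $\sigma(n) < 2n$. A positive integer $n$ is a primitive non-deficient number if $n$ is not deficient (i.e. $\sigma(n) \ge 2n$) but every proper divisor of $n$ is deficient. -}

module Defs where

open import Data.Nat using (ℕ; zero; suc; _+_; _*_; _^_; _<_; _≥_; _≤_)
open import Data.Nat.Divisibility using (_∣_; _∣?_)
open import Data.List using (List; filter; upTo; map)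
open import Data.Nat.ListAction using (sum)
open import Data.Fin using (Fin; zero; suc)
open import Data.Product using (_×_)
open import Relation.Nullary using (¬_)

-- σ n = sum of the positive divisors of n (σ 0 = 0 by this formula).
σ : ℕ → ℕ
σ n = sum (filter (_∣? n) (map suc (upTo n)))

Deficient : ℕ → Set
Deficient n = σ n < 2 * n

ProperDivisor : ℕ → ℕ → Set
ProperDivisor d n = d ∣ n × 1 ≤ d × d < n

PrimitiveNonDeficient : ℕ → Set
PrimitiveNonDeficient n =
  1 ≤ n × ¬ Deficient n × (∀ d → ProperDivisor d n → Deficient d)

∏ : (k : ℕ) → (Fin k → ℕ) → ℕ
∏ zero f = 1
∏ (suc k) f = f zero * ∏ k (λ i → f (suc i))

-- Write N = ∏ pᵢ^aᵢ, R = ∏ pᵢ, Xᵢ = pᵢ^(aᵢ+1), Yᵢ = Xᵢ - 1 and φ = ∏ (pᵢ - 1).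
-- Suppose, for a contradiction, that N is primitive non-deficient and Xᵢ ≥ M = 4R²
-- for every i.  By multiplicativity of σ and the geometric series,
-- φ·σ(N) = ∏ Yᵢ and R·N = ∏ Xᵢ.  Writing A = ∏_{i≥1} Yᵢ, B = ∏_{i≥1} Xᵢ:
--   * non-deficiency 2N ≤ σ(N) gives 2φN < φσ(N) + A = X₀A ≤ X₀B = RN,
--     i.e. 2φ + 1 ≤ R;
--   * the Weierstrass product inequality ∏(1 - 1/Xᵢ) ≥ 1 - k/M bounds B - A,
--     and together with 2φ + 1 ≤ R this yields 2φN ≤ (X₀ - p₀)·A.
-- Since (X₀ - p₀)·A = φ·p₀·σ(N/p₀), the proper divisor N/p₀ is non-deficient,
-- contradicting primitivity.  (For k = 0, N = 1 is deficient.)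

module Submission where

open import Defs
open import Data.Nat
open import Data.Nat.Properties
open import Data.Nat.Divisibility
open import Data.Nat.Primality using (Prime; prime; prime⇒irreducible; euclidsLemma)
open import Data.Nat.Coprimality using (Coprime; coprime-divisor)
open import Data.Nat.ListAction using (sum)
open import Data.Nat.ListAction.Properties using (sum-++)
open import Data.Nat.Tactic.RingSolver using (solve-∀)
open import Data.List using ([]; _∷_; _++_; filter; upTo; map; [_])
open import Data.List.Properties using (map-++; upTo-∷ʳ)
open import Data.Fin using (Fin; zero; suc)
open import Data.Fin.Properties using (any?) renaming (suc-injective to Fin-suc-injective)
open import Data.Product using (_,_; ∃-syntax)
open import Data.Sum using (inj₁; inj₂)
open import Data.Empty using (⊥-elim)
open import Function using (_∘_)
open import Function.Definitions using (Injective)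
open import Relation.Nullary using (¬_; Dec; yes; no; contradiction)
open import Relation.Binary.PropositionalEquality using (_≡_; _≢_; refl; sym; trans; cong; cong₂; subst; module ≡-Reasoning)

sumTo : (ℕ → ℕ) → ℕ → ℕ
sumTo f zero    = 0
sumTo f (suc n) = sumTo f n + f (suc n)

sumTo-cong : ∀ (f g : ℕ → ℕ) n → (∀ d → 1 ≤ d → d ≤ n → f d ≡ g d) → sumTo f n ≡ sumTo g n
sumTo-cong f g zero    _ = refl
sumTo-cong f g (suc n) h =
  cong₂ _+_ (sumTo-cong f g n (λ d 1≤d d≤n → h d 1≤d (m≤n⇒m≤1+n d≤n))) (h (suc n) (s≤s z≤n) ≤-refl)

sumTo-vanishing : ∀ (f : ℕ → ℕ) n → (∀ d → 1 ≤ d → d ≤ n → f d ≡ 0) → sumTo f n ≡ 0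
sumTo-vanishing f zero    _ = refl
sumTo-vanishing f (suc n) h =
  cong₂ _+_ (sumTo-vanishing f n (λ d 1≤d d≤n → h d 1≤d (m≤n⇒m≤1+n d≤n))) (h (suc n) (s≤s z≤n) ≤-refl)

sumTo-+ : ∀ (f g : ℕ → ℕ) n → sumTo (λ d → f d + g d) n ≡ sumTo f n + sumTo g n
sumTo-+ f g zero    = refl
sumTo-+ f g (suc n) =
  trans (cong (_+ (f (suc n) + g (suc n))) (sumTo-+ f g n))
        (interchange (sumTo f n) (sumTo g n) (f (suc n)) (g (suc n)))
  where
  interchange : ∀ a b c d → a + b + (c + d) ≡ a + c + (b + d)
  interchange = solve-∀

sumTo-* : ∀ c (f : ℕ → ℕ) n → sumTo (λ d → c * f d) n ≡ c * sumTo f n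
sumTo-* c f zero    = sym (*-zeroʳ c)
sumTo-* c f (suc n) =
  trans (cong (_+ c * f (suc n)) (sumTo-* c f n)) (sym (*-distribˡ-+ c (sumTo f n) (f (suc n))))

sumTo-split : ∀ (f : ℕ → ℕ) m t → sumTo f (m + t) ≡ sumTo f m + sumTo (λ r → f (m + r)) t
sumTo-split f m zero    = trans (cong (sumTo f) (+-identityʳ m)) (sym (+-identityʳ _))
sumTo-split f m (suc t) = begin
    sumTo f (m + suc t)                                   ≡⟨ cong (sumTo f) (+-suc m t) ⟩
    sumTo f (m + t) + f (suc (m + t))                     ≡⟨ cong (_+ f (suc (m + t))) (sumTo-split f m t) ⟩
    sumTo f m + tail t + f (suc (m + t))                  ≡⟨ +-assoc (sumTo f m) _ _ ⟩
    sumTo f m + (tail t + f (suc (m + t)))                ≡⟨ cong (λ x → sumTo f m + (tail t + f x)) (sym (+-suc m t)) ⟩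
    sumTo f m + tail (suc t)                              ∎
  where
  open ≡-Reasoning
  tail : ℕ → ℕ
  tail = sumTo (λ r → f (m + r))

sumTo-multiples : ∀ q M (g : ℕ → ℕ) → (∀ d → ¬ (suc q ∣ d) → g d ≡ 0) →
                  sumTo g (suc q * M) ≡ sumTo (λ e → g (suc q * e)) M
sumTo-multiples q zero    g g-off = cong (sumTo g) (*-zeroʳ q)
sumTo-multiples q (suc M) g g-off = begin
    sumTo g (p * suc M)                                   ≡⟨ cong (sumTo g) (trans (*-suc p M) (+-comm p (p * M))) ⟩
    sumTo g (p * M + p)                                   ≡⟨ sumTo-split g (p * M) p ⟩
    sumTo g (p * M) + (gap + g (p * M + p))               ≡⟨ cong₂ (λ x y → x + (y + g (p * M + p)))
                                                                   (sumTo-multiples q M g g-off) gap≡0 ⟩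
    sumTo (λ e → g (p * e)) M + g (p * M + p)             ≡⟨ cong (λ x → sumTo (λ e → g (p * e)) M + g x)
                                                                   (trans (+-comm (p * M) p) (sym (*-suc p M))) ⟩
    sumTo (λ e → g (p * e)) (suc M)                       ∎
  where
  open ≡-Reasoning
  p = suc q
  gap = sumTo (λ r → g (p * M + r)) q
  -- p·M + r is not a multiple of p for 1 ≤ r ≤ p - 1
  gap≡0 : gap ≡ 0
  gap≡0 = sumTo-vanishing _ q (λ { r@(suc _) _ r≤q → g-off _ (λ p∣ →
            <⇒≱ (s≤s r≤q) (∣⇒≤ (∣m+n∣m⇒∣n p∣ (m∣m*n M)))) })

keepIf : ∀ {P : Set} → Dec P → ℕ → ℕ
keepIf (yes _) x = x
keepIf (no _)  _ = 0

dropIf : ∀ {P : Set} → Dec P → ℕ → ℕ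
dropIf (yes _) _ = 0
dropIf (no _)  x = x

divisorTerm : ℕ → ℕ → ℕ
divisorTerm n d = keepIf (d ∣? n) d

sum-filter-divides : ∀ n xs → sum (filter (_∣? n) xs) ≡ sum (map (divisorTerm n) xs)
sum-filter-divides n []       = refl
sum-filter-divides n (x ∷ xs) with x ∣? n
... | yes _ = cong (x +_) (sum-filter-divides n xs)
... | no _  = sum-filter-divides n xs

sum-map-upTo : ∀ (f : ℕ → ℕ) n → sum (map f (map suc (upTo n))) ≡ sumTo f n
sum-map-upTo f zero    = refl
sum-map-upTo f (suc n) = begin
    sum (map f (map suc (upTo (suc n))))             ≡⟨ cong (sum ∘ map f ∘ map suc) (sym (upTo-∷ʳ n)) ⟩
    sum (map f (map suc (upTo n ++ [ n ])))          ≡⟨ cong (sum ∘ map f) (map-++ suc (upTo n) [ n ]) ⟩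
    sum (map f (map suc (upTo n) ++ [ suc n ]))      ≡⟨ cong sum (map-++ f (map suc (upTo n)) [ suc n ]) ⟩
    sum (map f (map suc (upTo n)) ++ [ f (suc n) ])  ≡⟨ sum-++ (map f (map suc (upTo n))) [ f (suc n) ] ⟩
    sum (map f (map suc (upTo n))) + (f (suc n) + 0) ≡⟨ cong₂ _+_ (sum-map-upTo f n) (+-identityʳ _) ⟩
    sumTo f (suc n)                                  ∎
  where open ≡-Reasoning

σ-as-sum : ∀ n → σ n ≡ sumTo (divisorTerm n) n
σ-as-sum n = trans (sum-filter-divides n (map suc (upTo n))) (sum-map-upTo (divisorTerm n) n)

-- The divisors of p·n' that are multiples of p (p = q + 1) are p·e for e ∣ n'; they contribute p·σ(n').
σ-multiples-part : ∀ q n' → sumTo (λ d → keepIf (suc q ∣? d) (divisorTerm (suc q * n') d)) (suc q * n')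
                            ≡ suc q * σ n'
σ-multiples-part q n' = begin
    sumTo term (p * n')                         ≡⟨ sumTo-multiples q n' term term-off ⟩
    sumTo (λ e → term (p * e)) n'               ≡⟨ sumTo-cong _ _ n' (λ e _ _ → term-on e) ⟩
    sumTo (λ e → p * divisorTerm n' e) n'       ≡⟨ sumTo-* p (divisorTerm n') n' ⟩
    p * sumTo (divisorTerm n') n'               ≡⟨ cong (p *_) (sym (σ-as-sum n')) ⟩
    p * σ n'                                    ∎
  where
  open ≡-Reasoning
  p = suc q
  term : ℕ → ℕ
  term d = keepIf (p ∣? d) (divisorTerm (p * n') d)
  term-off : ∀ d → ¬ (p ∣ d) → term d ≡ 0
  term-off d p∤d with p ∣? d
  ... | yes p∣d = contradiction p∣d p∤d
  ... | no _    = refl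
  -- p·e ∣ p·n' exactly when e ∣ n'
  term-on : ∀ e → term (p * e) ≡ p * divisorTerm n' e
  term-on e with p ∣? (p * e)
  ... | no p∤pe = contradiction (m∣m*n e) p∤pe
  ... | yes _ with (p * e) ∣? (p * n') | e ∣? n'
  ...   | yes _     | yes _    = refl
  ...   | yes pe∣pn | no e∤n   = contradiction (*-cancelˡ-∣ p pe∣pn) e∤n
  ...   | no pe∤pn  | yes e∣n  = contradiction (*-monoʳ-∣ p e∣n) pe∤pn
  ...   | no _      | no _     = sym (*-zeroʳ p)

-- Everything divides 0, so a number with a non-divisor is nonzero.
∤⇒nonZero : ∀ {p m} → ¬ (p ∣ m) → NonZero m
∤⇒nonZero {p} {zero}  p∤0 = contradiction (p ∣0) p∤0
∤⇒nonZero {p} {suc m} _   = _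

σ-non-multiples-part : ∀ p n m → .{{NonZero n}} → ¬ (p ∣ m) → m ∣ n →
                       (∀ d → d ∣ n → ¬ (p ∣ d) → d ∣ m) →
                       sumTo (λ d → dropIf (p ∣? d) (divisorTerm n d)) n ≡ σ m
σ-non-multiples-part p n m p∤m m∣n divisors-in-m = begin
    sumTo term n                                  ≡⟨ sumTo-cong _ _ n (λ d _ _ → term≡ d) ⟩
    sumTo (divisorTerm m) n                       ≡⟨ cong (sumTo (divisorTerm m)) (sym (m+[n∸m]≡n m≤n)) ⟩
    sumTo (divisorTerm m) (m + (n ∸ m))           ≡⟨ sumTo-split (divisorTerm m) m (n ∸ m) ⟩
    sumTo (divisorTerm m) m + beyond              ≡⟨ cong (sumTo (divisorTerm m) m +_) beyond≡0 ⟩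
    sumTo (divisorTerm m) m + 0                   ≡⟨ +-identityʳ _ ⟩
    sumTo (divisorTerm m) m                       ≡⟨ sym (σ-as-sum m) ⟩
    σ m                                           ∎
  where
  open ≡-Reasoning
  term : ℕ → ℕ
  term d = dropIf (p ∣? d) (divisorTerm n d)
  term≡ : ∀ d → term d ≡ divisorTerm m d
  term≡ d with p ∣? d
  ... | yes p∣d with d ∣? m
  ...   | yes d∣m = contradiction (∣-trans p∣d d∣m) p∤m
  ...   | no _    = refl
  term≡ d | no p∤d with d ∣? n | d ∣? m
  ... | yes _   | yes _    = refl
  ... | yes d∣n | no d∤m   = contradiction (divisors-in-m d d∣n p∤d) d∤m
  ... | no d∤n  | yes d∣m  = contradiction (∣-trans d∣m m∣n) d∤n
  ... | no _    | no _     = refl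
  m≢0 : NonZero m
  m≢0 = ∤⇒nonZero p∤m
  m≤n : m ≤ n
  m≤n = ∣⇒≤ m∣n
  beyond = sumTo (λ r → divisorTerm m (m + r)) (n ∸ m)
  beyond≡0 : beyond ≡ 0
  beyond≡0 = sumTo-vanishing _ (n ∸ m) vanish
    where
    vanish : ∀ r → 1 ≤ r → r ≤ n ∸ m → divisorTerm m (m + r) ≡ 0
    vanish r 1≤r _ with (m + r) ∣? m
    ... | yes m+r∣m = contradiction (∣⇒≤ {{m≢0}} m+r∣m) (<⇒≱ (m<m+n m 1≤r))
    ... | no _      = refl

-- Splitting the divisors of p·n' by divisibility by p:
-- σ(p·n') = p·σ(n') + σ(m), where m collects the divisors prime to p.
σ-peel : ∀ q n' m → .{{NonZero n'}} → ¬ (suc q ∣ m) → m ∣ n' →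
         (∀ d → d ∣ suc q * n' → ¬ (suc q ∣ d) → d ∣ m) →
         σ (suc q * n') ≡ suc q * σ n' + σ m
σ-peel q n' m p∤m m∣n' divisors-in-m = begin
    σ n                                                       ≡⟨ σ-as-sum n ⟩
    sumTo (divisorTerm n) n                                   ≡⟨ sumTo-cong _ _ n (λ d _ _ → split d) ⟩
    sumTo (λ d → onP d + offP d) n                            ≡⟨ sumTo-+ onP offP n ⟩
    sumTo onP n + sumTo offP n                                ≡⟨ cong₂ _+_ (σ-multiples-part q n')
                                                                   (σ-non-multiples-part p n m {{m*n≢0 p n'}}
                                                                     p∤m (∣-trans m∣n' (n∣m*n p)) divisors-in-m) ⟩
    p * σ n' + σ m                                            ∎
  where
  open ≡-Reasoning
  p = suc q
  n = p * n'
  onP offP : ℕ → ℕ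
  onP d  = keepIf (p ∣? d) (divisorTerm n d)
  offP d = dropIf (p ∣? d) (divisorTerm n d)
  split : ∀ d → divisorTerm n d ≡ onP d + offP d
  split d with p ∣? d
  ... | yes _ = sym (+-identityʳ _)
  ... | no _  = refl

p∤1 : ∀ {p} → Prime p → ¬ (p ∣ 1)
p∤1 pr p∣1 with ∣1⇒≡1 p∣1
p∤1 (prime {{()}} _) _ | refl

prime≥2 : ∀ {p} → Prime p → 2 ≤ p
prime≥2 {p} (prime _) = nonTrivial⇒n>1 p

prime∤⇒coprime : ∀ {p d} → Prime p → ¬ (p ∣ d) → Coprime d p
prime∤⇒coprime pr p∤d {c} (c∣d , c∣p) with prime⇒irreducible pr c∣p
... | inj₁ c≡1 = c≡1
... | inj₂ refl = contradiction c∣d p∤d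

∣-cancel-prime-power : ∀ {p} → Prime p → ∀ a x d → ¬ (p ∣ d) → d ∣ p ^ a * x → d ∣ x
∣-cancel-prime-power pr zero x d p∤d d∣ = subst (d ∣_) (*-identityˡ x) d∣
∣-cancel-prime-power {p} pr (suc a) x d p∤d d∣ =
  ∣-cancel-prime-power pr a x d p∤d
    (coprime-divisor (prime∤⇒coprime pr p∤d) (subst (d ∣_) (*-assoc p (p ^ a) x) d∣))

-- σ(p^(a+1)·m) = p·σ(p^a·m) + σ(m) for p ∤ m: the divisors prime to p are those of m.
σ-prime-power-step : ∀ {p} → Prime p → ∀ a m → ¬ (p ∣ m) →
                     σ (p ^ suc a * m) ≡ p * σ (p ^ a * m) + σ m
σ-prime-power-step {zero} (prime {{()}} _)
σ-prime-power-step {p@(suc q)} pr a m p∤m =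
  trans (cong σ (*-assoc p (p ^ a) m))
        (σ-peel q (p ^ a * m) m {{m*n≢0 (p ^ a) m {{m^n≢0 p a}} {{m≢0}}}} p∤m (n∣m*n (p ^ a))
          (λ d d∣ p∤d → ∣-cancel-prime-power pr (suc a) m d p∤d (subst (d ∣_) (sym (*-assoc p (p ^ a) m)) d∣)))
  where
  m≢0 : NonZero m
  m≢0 = ∤⇒nonZero p∤m

σ-prime-power-succ : ∀ {p} → Prime p → ∀ a → σ (p ^ suc a) ≡ p * σ (p ^ a) + 1
σ-prime-power-succ {p} pr a = begin
    σ (p ^ suc a)             ≡⟨ cong σ (sym (*-identityʳ (p ^ suc a))) ⟩
    σ (p ^ suc a * 1)         ≡⟨ σ-prime-power-step pr a 1 (p∤1 pr) ⟩
    p * σ (p ^ a * 1) + σ 1   ≡⟨ cong (λ x → p * σ x + 1) (*-identityʳ (p ^ a)) ⟩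
    p * σ (p ^ a) + 1         ∎
  where open ≡-Reasoning

σ-prime-power-mult : ∀ {p} → Prime p → ∀ a m → ¬ (p ∣ m) → σ (p ^ a * m) ≡ σ (p ^ a) * σ m
σ-prime-power-mult pr zero m p∤m = trans (cong σ (*-identityˡ m)) (sym (*-identityˡ (σ m)))
σ-prime-power-mult {p} pr (suc a) m p∤m = begin
    σ (p ^ suc a * m)                    ≡⟨ σ-prime-power-step pr a m p∤m ⟩
    p * σ (p ^ a * m) + σ m              ≡⟨ cong (λ x → p * x + σ m) (σ-prime-power-mult pr a m p∤m) ⟩
    p * (σ (p ^ a) * σ m) + σ m          ≡⟨ regroup p (σ (p ^ a)) (σ m) ⟩
    (p * σ (p ^ a) + 1) * σ m            ≡⟨ cong (_* σ m) (sym (σ-prime-power-succ pr a)) ⟩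
    σ (p ^ suc a) * σ m                  ∎
  where
  open ≡-Reasoning
  regroup : ∀ p s t → p * (s * t) + t ≡ (p * s + 1) * t
  regroup = solve-∀

σ-prime-power-geometric : ∀ {p} → Prime p → ∀ a → (p ∸ 1) * σ (p ^ a) + 1 ≡ p ^ suc a
σ-prime-power-geometric {zero} (prime {{()}} _)
σ-prime-power-geometric {suc q} pr zero = base q
  where
  base : ∀ q → q * 1 + 1 ≡ suc q * 1
  base = solve-∀
σ-prime-power-geometric {p@(suc q)} pr (suc a) = begin
    q * σ (p ^ suc a) + 1                ≡⟨ cong (λ x → q * x + 1) (σ-prime-power-succ pr a) ⟩
    q * (p * σ (p ^ a) + 1) + 1          ≡⟨ regroup q (σ (p ^ a)) ⟩
    p * (q * σ (p ^ a) + 1)              ≡⟨ cong (p *_) (σ-prime-power-geometric pr a) ⟩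
    p ^ suc (suc a)                      ∎
  where
  open ≡-Reasoning
  regroup : ∀ q s → q * (suc q * s + 1) + 1 ≡ suc q * (q * s + 1)
  regroup = solve-∀

∏-mult : ∀ k (f g : Fin k → ℕ) → ∏ k (λ i → f i * g i) ≡ ∏ k f * ∏ k g
∏-mult zero    f g = refl
∏-mult (suc k) f g = trans (cong (f zero * g zero *_) (∏-mult k _ _)) (interchange (f zero) (g zero) _ _)
  where
  interchange : ∀ a b c d → a * b * (c * d) ≡ a * c * (b * d)
  interchange = solve-∀

∏-mono : ∀ k (f g : Fin k → ℕ) → (∀ i → f i ≤ g i) → ∏ k f ≤ ∏ k g
∏-mono zero    f g h = ≤-refl
∏-mono (suc k) f g h = *-mono-≤ (h zero) (∏-mono k _ _ (λ i → h (suc i)))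

∏-pos : ∀ k (f : Fin k → ℕ) → (∀ i → 1 ≤ f i) → 1 ≤ ∏ k f
∏-pos zero    f h = ≤-refl
∏-pos (suc k) f h = *-mono-≤ (h zero) (∏-pos k (f ∘ suc) (h ∘ suc))

∏-big : ∀ k (f : Fin k → ℕ) → (∀ i → 2 ≤ f i) → k < ∏ k f
∏-big zero    f h = s≤s z≤n
∏-big (suc k) f h = begin-strict
    suc k                 <⟨ s≤s ih ⟩
    suc (∏ k f')          ≤⟨ +-monoʳ-≤ 1 (m≤m+n (∏ k f') 0) ⟩
    1 + (∏ k f' + 0)      ≤⟨ +-monoˡ-≤ (∏ k f' + 0) (≤-trans (s≤s z≤n) ih) ⟩
    2 * ∏ k f'            ≤⟨ *-monoˡ-≤ (∏ k f') (h zero) ⟩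
    f zero * ∏ k f'       ∎
  where
  open ≤-Reasoning
  f' = λ i → f (suc i)
  ih = ∏-big k f' (λ i → h (suc i))

prime∣prime-power : ∀ {r f} → Prime r → Prime f → ∀ b → r ∣ f ^ b → r ≡ f
prime∣prime-power pr pf zero r∣1 = ⊥-elim (p∤1 pr r∣1)
prime∣prime-power {r} {f} pr pf (suc b) r∣ with euclidsLemma f (f ^ b) pr r∣
... | inj₂ r∣fᵇ = prime∣prime-power pr pf b r∣fᵇ
... | inj₁ r∣f with prime⇒irreducible pf r∣f
...   | inj₁ r≡1 = ⊥-elim (p∤1 pr (subst (r ∣_) r≡1 (∣-refl {r})))
...   | inj₂ r≡f  = r≡f

prime∤∏ : ∀ k (f b : Fin k → ℕ) r → Prime r → (∀ i → Prime (f i)) → (∀ i → r ≢ f i) →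
          ¬ (r ∣ ∏ k (λ i → f i ^ b i))
prime∤∏ zero    f b r pr pf r≢ r∣ = p∤1 pr r∣
prime∤∏ (suc k) f b r pr pf r≢ r∣ with euclidsLemma (f zero ^ b zero) _ pr r∣
... | inj₁ r∣head = r≢ zero (prime∣prime-power pr (pf zero) (b zero) r∣head)
... | inj₂ r∣tail = prime∤∏ k (f ∘ suc) (b ∘ suc) r pr (pf ∘ suc) (r≢ ∘ suc) r∣tail

head∤tail : ∀ k (p a : Fin (suc k) → ℕ) → (∀ i → Prime (p i)) → Injective _≡_ _≡_ p →
            ¬ (p zero ∣ ∏ k (λ i → p (suc i) ^ a (suc i)))
head∤tail k p a pr inj = prime∤∏ k (p ∘ suc) (a ∘ suc) (p zero) (pr zero) (pr ∘ suc) (λ i eq → zero≢suc (inj eq))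
  where
  zero≢suc : ∀ {i : Fin k} → ¬ (zero ≡ suc i)
  zero≢suc ()

σ-∏ : ∀ k (p a : Fin k → ℕ) → (∀ i → Prime (p i)) → Injective _≡_ _≡_ p →
      σ (∏ k (λ i → p i ^ a i)) ≡ ∏ k (λ i → σ (p i ^ a i))
σ-∏ zero    p a pr inj = refl
σ-∏ (suc k) p a pr inj =
  trans (σ-prime-power-mult (pr zero) (a zero) _ (head∤tail k p a pr inj))
        (cong (σ (p zero ^ a zero) *_) (σ-∏ k (p ∘ suc) (a ∘ suc) (pr ∘ suc) (Fin-suc-injective ∘ inj)))

φσ-∏ : ∀ k (p a : Fin k → ℕ) → (∀ i → Prime (p i)) → Injective _≡_ _≡_ p →
       ∏ k (λ i → p i ∸ 1) * σ (∏ k (λ i → p i ^ a i)) ≡ ∏ k (λ i → (p i ∸ 1) * σ (p i ^ a i))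
φσ-∏ k p a pr inj =
  trans (cong (∏ k (λ i → p i ∸ 1) *_) (σ-∏ k p a pr inj)) (sym (∏-mult k _ _))

-- One factor of the Weierstrass inequality: multiplying the bound for A ≤ B by x = y + 1 ≥ M.
weierstrass-step : ∀ y A B M k → M ≤ suc y → A ≤ B → M * B ≤ A * M + k * B →
                   M * (suc y * B) ≤ y * A * M + suc k * (suc y * B)
weierstrass-step y A B M k M≤x A≤B ih = begin
    M * (suc y * B)                              ≡⟨ e₁ M y B ⟩
    suc y * (M * B)                              ≤⟨ *-monoʳ-≤ (suc y) ih ⟩
    suc y * (A * M + k * B)                      ≡⟨ e₂ y A M k B ⟩
    y * A * M + A * M + k * (suc y * B)          ≤⟨ +-monoˡ-≤ (k * (suc y * B)) (+-monoʳ-≤ (y * A * M) (*-mono-≤ A≤B M≤x)) ⟩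
    y * A * M + B * suc y + k * (suc y * B)      ≡⟨ e₃ y A M B k ⟩
    y * A * M + suc k * (suc y * B)              ∎
  where
  open ≤-Reasoning
  e₁ : ∀ M y B → M * (suc y * B) ≡ suc y * (M * B)
  e₁ = solve-∀
  e₂ : ∀ y A M k B → suc y * (A * M + k * B) ≡ y * A * M + A * M + k * (suc y * B)
  e₂ = solve-∀
  e₃ : ∀ y A M B k → y * A * M + B * suc y + k * (suc y * B) ≡ y * A * M + suc k * (suc y * B)
  e₃ = solve-∀

-- Weierstrass product inequality in integer form: if Xᵢ = Yᵢ + 1 ≥ M then
-- M·∏ Xᵢ ≤ M·∏ Yᵢ + k·∏ Xᵢ, i.e. ∏ (1 - 1/Xᵢ) ≥ 1 - k/M.
weierstrass : ∀ k (Y X : Fin k → ℕ) M → (∀ i → suc (Y i) ≡ X i) → (∀ i → M ≤ X i) →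
              M * ∏ k X ≤ ∏ k Y * M + k * ∏ k X
weierstrass zero    Y X M _ _ = ≤-reflexive (trans (*-identityʳ M) (sym (trans (+-identityʳ _) (*-identityˡ M))))
weierstrass (suc k) Y X M Y+1≡X M≤X
  rewrite sym (Y+1≡X zero) =
  weierstrass-step (Y zero) (∏ k (Y ∘ suc)) (∏ k (X ∘ suc)) M k (subst (M ≤_) (sym (Y+1≡X zero)) (M≤X zero))
    (∏-mono k _ _ (λ i → subst (Y (suc i) ≤_) (Y+1≡X (suc i)) (n≤1+n _)))
    (weierstrass k (Y ∘ suc) (X ∘ suc) M (Y+1≡X ∘ suc) (M≤X ∘ suc))

-- Non-deficiency forces R to be large compared with φ: if 2N ≤ σ(N), φ·σ(N) + A = X₀·A,
-- A ≤ B, R·N = X₀·B and A ≥ 1, then 2φ + 1 ≤ R (as 2φN ≤ φσ(N) < X₀A ≤ X₀B = RN).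
nondeficient⇒φ-small : ∀ N σN φ A B X₀ R → 2 * N ≤ σN → φ * σN + A ≡ X₀ * A → A ≤ B →
                       R * N ≡ X₀ * B → 1 ≤ A → 2 * φ + 1 ≤ R
nondeficient⇒φ-small N σN φ A B X₀ R 2N≤σN φσN+A≡X₀A A≤B RN≡X₀B 1≤A =
  subst (_≤ R) (+-comm 1 (2 * φ)) (*-cancelʳ-< N (2 * φ) R 2φN<RN)
  where
  open ≤-Reasoning
  2φN<RN : 2 * φ * N < R * N
  2φN<RN = begin-strict
      2 * φ * N     ≡⟨ regroup φ N ⟩
      φ * (2 * N)   ≤⟨ *-monoʳ-≤ φ 2N≤σN ⟩
      φ * σN        <⟨ m<m+n (φ * σN) 1≤A ⟩
      φ * σN + A    ≡⟨ φσN+A≡X₀A ⟩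
      X₀ * A        ≤⟨ *-monoʳ-≤ X₀ A≤B ⟩
      X₀ * B        ≡⟨ sym RN≡X₀B ⟩
      R * N         ∎
    where
    regroup : ∀ φ N → 2 * φ * N ≡ φ * (2 * N)
    regroup = solve-∀

excess-coefficient-bound : ∀ R p₀ k Z X₀ → p₀ ≤ R → k ≤ R → 4 * (R * R) ≤ X₀ → Z ≤ X₀ →
                           R * (4 * (R * R)) * p₀ + R * k * Z ≤ 4 * (R * R) * X₀
excess-coefficient-bound R p₀ k Z X₀ p₀≤R k≤R M≤X₀ Z≤X₀ = begin
    R * M * p₀ + R * k * Z
  ≤⟨ +-mono-≤ (*-monoʳ-≤ (R * M) p₀≤R) (*-mono-≤ (*-monoʳ-≤ R k≤R) Z≤X₀) ⟩
    R * M * R + R * R * X₀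
  ≡⟨ cong (_+ R * R * X₀) (e₁ R M) ⟩
    R * R * M + R * R * X₀
  ≤⟨ +-monoˡ-≤ (R * R * X₀) (*-monoʳ-≤ (R * R) M≤X₀) ⟩
    R * R * X₀ + R * R * X₀
  ≤⟨ m≤m+n (R * R * X₀ + R * R * X₀) (2 * (R * R * X₀)) ⟩
    R * R * X₀ + R * R * X₀ + 2 * (R * R * X₀)
  ≡⟨ e₂ R X₀ ⟩
    M * X₀ ∎
  where
  open ≤-Reasoning
  M = 4 * (R * R)
  e₁ : ∀ R M → R * M * R ≡ R * R * M
  e₁ = solve-∀
  e₂ : ∀ R X₀ → R * R * X₀ + R * R * X₀ + 2 * (R * R * X₀) ≡ 4 * (R * R) * X₀
  e₂ = solve-∀

-- Indeed R·M·X₀·B ≤ R·M·(Z·A + N) by the coefficient bound, so (2φ + 1)N ≤ RN ≤ ZA + N.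
cofactor-estimate : ∀ R p₀ k Z A B N φ → let M = 4 * (R * R) in
  R * N ≡ (p₀ + Z) * B → M * B ≤ A * M + k * B → p₀ ≤ R → k ≤ R → M ≤ p₀ + Z →
  2 * φ + 1 ≤ R → 1 ≤ R → 2 * φ * N ≤ Z * A
cofactor-estimate R p₀ k Z A B N φ RN≡X₀B weierstrass-bound p₀≤R k≤R M≤X₀ φ-small 1≤R =
  +-cancelʳ-≤ N (2 * φ * N) (Z * A) (begin
      2 * φ * N + N          ≡⟨ cong (2 * φ * N +_) (sym (*-identityˡ N)) ⟩
      2 * φ * N + 1 * N      ≡⟨ sym (*-distribʳ-+ N (2 * φ) 1) ⟩
      (2 * φ + 1) * N        ≤⟨ *-monoˡ-≤ N φ-small ⟩
      R * N                  ≡⟨ RN≡X₀B ⟩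
      (p₀ + Z) * B           ≤⟨ *-cancelˡ-≤ (R * M) {{RM≢0}} scaled ⟩
      Z * A + N              ∎)
  where
  open ≤-Reasoning
  M = 4 * (R * R)
  RM≢0 : NonZero (R * M)
  RM≢0 = >-nonZero (*-mono-< 1≤R (*-monoʳ-< 4 (*-mono-< 1≤R 1≤R)))
  scaled : R * M * ((p₀ + Z) * B) ≤ R * M * (Z * A + N)
  scaled = begin
      R * M * ((p₀ + Z) * B)
    ≡⟨ e₁ R M p₀ Z B ⟩
      R * M * p₀ * B + R * (Z * (M * B))
    ≤⟨ +-monoʳ-≤ (R * M * p₀ * B) (*-monoʳ-≤ R (*-monoʳ-≤ Z weierstrass-bound)) ⟩
      R * M * p₀ * B + R * (Z * (A * M + k * B))
    ≡⟨ e₂ R M p₀ B Z A k ⟩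
      R * M * (Z * A) + (R * M * p₀ + R * k * Z) * B
    ≤⟨ +-monoʳ-≤ (R * M * (Z * A))
         (*-monoˡ-≤ B (excess-coefficient-bound R p₀ k Z (p₀ + Z) p₀≤R k≤R M≤X₀ (m≤n+m Z p₀))) ⟩
      R * M * (Z * A) + M * (p₀ + Z) * B
    ≡⟨ cong (R * M * (Z * A) +_) (trans (*-assoc M (p₀ + Z) B) (cong (M *_) (sym RN≡X₀B))) ⟩
      R * M * (Z * A) + M * (R * N)
    ≡⟨ e₃ R M Z A N ⟩
      R * M * (Z * A + N) ∎
    where
    e₁ : ∀ R M p₀ Z B → R * M * ((p₀ + Z) * B) ≡ R * M * p₀ * B + R * (Z * (M * B))
    e₁ = solve-∀
    e₂ : ∀ R M p₀ B Z A k → R * M * p₀ * B + R * (Z * (A * M + k * B))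
                          ≡ R * M * (Z * A) + (R * M * p₀ + R * k * Z) * B
    e₂ = solve-∀
    e₃ : ∀ R M Z A N → R * M * (Z * A) + M * (R * N) ≡ R * M * (Z * A + N)
    e₃ = solve-∀

prime-power-excess : ∀ {p} → Prime p → ∀ b → p * p ^ suc b ≡ p + (p ∸ 1) * σ (p ^ b) * p
prime-power-excess {p} pr b = begin
    p * p ^ suc b                    ≡⟨ cong (p *_) (sym (σ-prime-power-geometric pr b)) ⟩
    p * ((p ∸ 1) * σ (p ^ b) + 1)    ≡⟨ regroup p ((p ∸ 1) * σ (p ^ b)) ⟩
    p + (p ∸ 1) * σ (p ^ b) * p      ∎
  where
  open ≡-Reasoning
  regroup : ∀ p y → p * (y + 1) ≡ p + y * p
  regroup = solve-∀

module Cofactor (k : ℕ) (p a : Fin (suc k) → ℕ) (b : ℕ)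
                (primes : ∀ i → Prime (p i)) (distinct : Injective _≡_ _≡_ p) (a₀≡ : a zero ≡ suc b) where

  p₀ R N T d M : ℕ
  p₀ = p zero
  R  = ∏ (suc k) p
  N  = ∏ (suc k) (λ i → p i ^ a i)
  T  = ∏ k (λ i → p (suc i) ^ a (suc i))
  d  = p₀ ^ b * T
  M  = 4 * (R * R)

  X Y : Fin (suc k) → ℕ
  X i = p i ^ suc (a i)
  Y i = (p i ∸ 1) * σ (p i ^ a i)

  φ A B Z : ℕ
  φ = ∏ (suc k) (λ i → p i ∸ 1)
  A = ∏ k (Y ∘ suc)
  B = ∏ k (X ∘ suc)
  Z = (p₀ ∸ 1) * σ (p₀ ^ b) * p₀

  Y+1≡X : ∀ i → suc (Y i) ≡ X i
  Y+1≡X i = trans (+-comm 1 (Y i)) (σ-prime-power-geometric (primes i) (a i))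

  N≡p₀d : N ≡ p₀ * d
  N≡p₀d = trans (cong (λ e → p₀ ^ e * T) a₀≡) (*-assoc p₀ (p₀ ^ b) T)

  X₀≡p₀+Z : X zero ≡ p₀ + Z
  X₀≡p₀+Z = trans (cong (λ e → p₀ * p₀ ^ e) a₀≡) (prime-power-excess (primes zero) b)

  RN≡X₀B : R * N ≡ X zero * B
  RN≡X₀B = sym (∏-mult (suc k) p (λ i → p i ^ a i))

  φσN+A≡X₀A : φ * σ N + A ≡ X zero * A
  φσN+A≡X₀A = begin
      φ * σ N + A          ≡⟨ cong (_+ A) (φσ-∏ (suc k) p a primes distinct) ⟩
      Y zero * A + A       ≡⟨ +-comm (Y zero * A) A ⟩
      suc (Y zero) * A     ≡⟨ cong (_* A) (Y+1≡X zero) ⟩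
      X zero * A           ∎
    where open ≡-Reasoning

  -- σ(d) = σ(p₀^b)·σ(T), and φ_T·σ(T) = A for the tail φ_T = ∏_{i≥1} (pᵢ - 1); so Z·A = σ(d)·φ·p₀.
  ZA≡σd·φp₀ : Z * A ≡ σ d * (φ * p₀)
  ZA≡σd·φp₀ = begin
      Z * A                                       ≡⟨ cong (Z *_) (sym (φσ-∏ k (p ∘ suc) (a ∘ suc) (primes ∘ suc) (Fin-suc-injective ∘ distinct))) ⟩
      Z * (φ-tail * σ T)                          ≡⟨ regroup (p₀ ∸ 1) (σ (p₀ ^ b)) p₀ φ-tail (σ T) ⟩
      σ (p₀ ^ b) * σ T * ((p₀ ∸ 1) * φ-tail * p₀) ≡⟨ cong (_* (φ * p₀)) (sym (σ-prime-power-mult (primes zero) b T (head∤tail k p a primes distinct))) ⟩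
      σ d * (φ * p₀)                              ∎
    where
    open ≡-Reasoning
    φ-tail = ∏ k (λ i → p (suc i) ∸ 1)
    regroup : ∀ u s q f t → u * s * q * (f * t) ≡ s * t * (u * f * q)
    regroup = solve-∀

  p-pos : ∀ i → 1 ≤ p i
  p-pos i = ≤-trans (s≤s z≤n) (prime≥2 (primes i))

  R≥1 : 1 ≤ R
  R≥1 = ∏-pos (suc k) p p-pos

  p₀≤R : p₀ ≤ R
  p₀≤R = m≤m*n p₀ _ {{>-nonZero (∏-pos k (p ∘ suc) (p-pos ∘ suc))}}

  k≤R : k ≤ R
  k≤R = ≤-trans (n≤1+n k) (<⇒≤ (∏-big (suc k) p (prime≥2 ∘ primes)))

  φp₀≢0 : NonZero (φ * p₀)
  φp₀≢0 = >-nonZero (*-mono-≤ (∏-pos (suc k) _ (λ i → m<n⇒0<n∸m (prime≥2 (primes i)))) (p-pos zero))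

  key-estimate : (∀ i → M ≤ X i) → 2 * N ≤ σ N → 2 * φ * N ≤ Z * A
  key-estimate X-big 2N≤σN =
    cofactor-estimate R p₀ k Z A B N φ (trans RN≡X₀B (cong (_* B) X₀≡p₀+Z))
      (weierstrass k (Y ∘ suc) (X ∘ suc) M (Y+1≡X ∘ suc) (X-big ∘ suc))
      p₀≤R k≤R (subst (M ≤_) X₀≡p₀+Z (X-big zero)) φ-small R≥1
    where
    -- each Yᵢ + 1 = Xᵢ ≥ 4R² ≥ 2, so A ≥ 1
    2≤M : 2 ≤ M
    2≤M = ≤-trans (s≤s (s≤s z≤n)) (*-monoʳ-≤ 4 (*-mono-≤ R≥1 R≥1))
    Y≥1 : ∀ i → 1 ≤ Y i
    Y≥1 i = s≤s⁻¹ (subst (2 ≤_) (sym (Y+1≡X i)) (≤-trans 2≤M (X-big i)))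
    A≤B : A ≤ B
    A≤B = ∏-mono k _ _ (λ i → subst (Y (suc i) ≤_) (Y+1≡X (suc i)) (n≤1+n _))
    φ-small : 2 * φ + 1 ≤ R
    φ-small = nondeficient⇒φ-small N (σ N) φ A B (X zero) R 2N≤σN φσN+A≡X₀A A≤B RN≡X₀B (∏-pos k _ (Y≥1 ∘ suc))

  cofactor-nondeficient : (∀ i → M ≤ X i) → ¬ Deficient N → ¬ Deficient d
  cofactor-nondeficient X-big N-nondef = ≤⇒≯ (*-cancelʳ-≤ (2 * d) (σ d) (φ * p₀) {{φp₀≢0}} (begin
      2 * d * (φ * p₀)    ≡⟨ regroup d φ p₀ ⟩
      2 * φ * (p₀ * d)    ≡⟨ cong (2 * φ *_) (sym N≡p₀d) ⟩
      2 * φ * N           ≤⟨ key-estimate X-big (≮⇒≥ N-nondef) ⟩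
      Z * A               ≡⟨ ZA≡σd·φp₀ ⟩
      σ d * (φ * p₀)      ∎))
    where
    open ≤-Reasoning
    regroup : ∀ d φ p₀ → 2 * d * (φ * p₀) ≡ 2 * φ * (p₀ * d)
    regroup = solve-∀

  cofactor-proper : ProperDivisor d N
  cofactor-proper = subst (d ∣_) (sym N≡p₀d) (n∣m*n p₀) , d≥1 , subst (d <_) (sym N≡p₀d) (d<p₀d)
    where
    d≥1 : 1 ≤ d
    d≥1 = *-mono-≤ (m^n>0 p₀ {{>-nonZero (p-pos zero)}} b)
                   (∏-pos k _ (λ i → m^n>0 (p (suc i)) {{>-nonZero (p-pos (suc i))}} (a (suc i))))
    d<p₀d : d < p₀ * d
    d<p₀d = subst (d <_) (*-comm d p₀) (m<m*n d p₀ {{>-nonZero d≥1}} (prime≥2 (primes zero)))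

mainTheorem1 : (N k : ℕ) (p a : Fin k → ℕ) →
    PrimitiveNonDeficient N →
    (∀ i → Prime (p i)) →
    Injective _≡_ _≡_ p →
    (∀ i → 1 ≤ a i) →
    N ≡ ∏ k (λ i → p i ^ a i) →
    ∃[ j ] (p j ^ suc (a j) < 4 * (∏ k p * ∏ k p))
mainTheorem1 N k p a _ _ _ _ refl with any? (λ j → p j ^ suc (a j) <? 4 * (∏ k p * ∏ k p))
... | yes small = small
mainTheorem1 N zero p a (_ , N-nondef , _) _ _ _ refl | no _ = contradiction (s≤s (s≤s z≤n)) N-nondef
mainTheorem1 N (suc k) p a (_ , N-nondef , proper-deficient) primes distinct a≥1 refl | no none =
  contradiction (proper-deficient d cofactor-proper) (cofactor-nondeficient X-big N-nondef)
  where
  open Cofactor k p a (pred (a zero)) primes distinct (sym (suc-pred (a zero) {{>-nonZero (a≥1 zero)}}))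
  X-big : ∀ i → M ≤ X i
  X-big i = ≮⇒≥ (λ small → none (i , small))
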